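{- There exists a function $f_{\mathcal{A}}\colon\mathbb{N}^2\to\mathbb{N}$ such that for all $d,\Delta\in\mathbb{N}$, if $G$ is a connected finite graph with maximum degree at most $\Delta$ and $\mathcal{A}\subseteq V(G)$ satisfies $|\mathcal{A}|\ge f_{\mathcal{A}}(d,\Delta)$, then $G$ contains $d$ pairwise anti-complete $\mathcal{A}$-paths.
   Context: An $\mathcal{A}$-path in $G$ is a path of length at least $1$ both of whose end-vertices lie in $\mathcal{A}$. Two vertex sets (or subgraphs) $X,Y$ are anti-complete if $X\cap Y=\emptyset$ and no edge of $G$ has one end in $X$ and the other in $Y$. -}

module Defs where

open import Data.Nat using (ℕ; _≤_)
open import Data.Bool using (Bool; T)
open import Data.Fin using (Fin)
open import Data.Fin.Subset using (Subset; _∈_)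
open import Data.List using (List; _∷_; []; _++_; [_]; length; filterᵇ)
open import Data.List.Relation.Unary.Linked using (Linked)
import Data.List.Membership.Propositional as LM
open import Data.List.Relation.Unary.Unique.Propositional using (Unique)
open import Data.List.Base using (allFin)
open import Data.Product using (_×_)
open import Data.Empty using (⊥)
open import Relation.Nullary using (¬_)
open import Relation.Binary.PropositionalEquality using (_≡_)
open import Relation.Binary.Construct.Closure.ReflexiveTransitive using (Star)

record Graph (n : ℕ) : Set where
  field
    adj   : Fin n → Fin n → Bool
    sym   : ∀ u v → adj u v ≡ adj v u
    irrfl : ∀ v → adj v v ≡ Data.Bool.false

open Graph public

Adj : ∀ {n} → Graph n → Fin n → Fin n → Set
Adj G u v = T (adj G u v)

degree : ∀ {n} → Graph n → Fin n → ℕ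
degree {n} G v = length (filterᵇ (adj G v) (allFin n))

MaxDegreeAtMost : ∀ {n} → Graph n → ℕ → Set
MaxDegreeAtMost {n} G Δ = ∀ (v : Fin n) → degree G v ≤ Δ

Connected : ∀ {n} → Graph n → Set
Connected {n} G = ∀ (u v : Fin n) → Star (Adj G) u v

-- A path in G: a list of distinct vertices, consecutive ones adjacent,
-- with first vertex `start`, last vertex `end`; it has length ≥ 1 (start ≠ end as vertices are distinct).
record Path {n : ℕ} (G : Graph n) : Set where
  field
    start    : Fin n
    interior : List (Fin n)
    end      : Fin n
    linked   : Linked (Adj G) (start ∷ interior ++ [ end ])
    distinct : Unique (start ∷ interior ++ [ end ])

open Path public

vertices : ∀ {n} {G : Graph n} → Path G → List (Fin n)
vertices P = start P ∷ interior P ++ [ end P ]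

IsAPath : ∀ {n} {G : Graph n} → Subset n → Path G → Set
IsAPath 𝒜 P = (start P ∈ 𝒜) × (end P ∈ 𝒜)

AntiComplete : ∀ {n} {G : Graph n} → Path G → Path G → Set
AntiComplete {n} {G} P Q =
  (∀ (x : Fin n) → x LM.∈ vertices P → ¬ (x LM.∈ vertices Q))
  × (∀ (x y : Fin n) → x LM.∈ vertices P → y LM.∈ vertices Q → ¬ Adj G x y)

{-# OPTIONS --safe #-}
-- Induction on d inside a connected (decidable) region U of G holding many 𝒜-vertices.  Let P be a
-- shortest 𝒜-walk in U, from a to b.  By minimality every 𝒜-vertex within distance 1 of P is b or within
-- distance 2 of a, so deleting the closed neighbourhood N[P] loses few 𝒜-vertices.  If one component of
-- U − N[P] still holds many 𝒜-vertices, recurse into it and add P.  Otherwise many components contain an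
-- 𝒜-vertex z; walking from z towards P, the first vertex within distance 2 of P is the hook of z, attached
-- at some position of P.  Hooks of different components are distinct and P is a geodesic of U, so at most
-- (Δ + 1) ^ 6 hooks attach within any 5 consecutive positions; hence d pairs of hooks can be chosen whose
-- position intervals are 5 apart.  Joining each pair through its segment of P gives d 𝒜-paths, and
-- geodesicity makes paths over intervals 5 apart anticomplete.
module Submission where

open import Defs using (Graph; adj; Adj; Connected; MaxDegreeAtMost; Path; start; end; vertices; IsAPath; AntiComplete)
open import Level using (0ℓ)
open import Data.Bool using (T; true; false)
open import Data.Bool.Properties using (T?)
open import Data.Empty using (⊥)
open import Data.Unit using (⊤; tt)
open import Data.Nat using (ℕ; zero; suc; _+_; _*_; _∸_; _^_; _≤_; _<_; _≤?_; _<?_; z≤n; s≤s; s≤s⁻¹; z<s)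
open import Data.Nat.Properties
open import Data.Nat.Induction using (<-rec)
open import Data.Fin using (Fin; zero; suc) renaming (_≟_ to _≟ᶠ_)
open import Data.Fin.Properties using (any?)
import Data.Fin.Properties as Fin
open import Data.Fin.Subset using (Subset; ∣_∣) renaming (_∈_ to _∈ₛ_)
open import Data.Fin.Subset.Properties using (_∈?_)
open import Data.Vec using ([]; _∷_; here; there)
open import Data.List using (List; []; _∷_; [_]; _++_; length; map; filter; filterᵇ; concatMap; applyUpTo; allFin)
open import Data.List.Properties using (length-++; length-map; length-applyUpTo; length-tabulate; applyUpTo-∷ʳ)
open import Data.List.Membership.Propositional using (_∈_)
open import Data.List.Membership.Propositional.Properties
  using (∈-filter⁺; ∈-filter⁻; ∈-map⁻; ∈-allFin; ∈-concatMap⁺; ∈-applyUpTo⁻)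
open import Data.List.Relation.Unary.All as All using (All; []; _∷_)
open import Data.List.Relation.Unary.All.Properties using (all-filter; filter⁺)
open import Data.List.Relation.Unary.Any as Any using (here; there)
open import Data.List.Relation.Unary.Linked using (Linked)
import Data.List.Relation.Unary.Linked.Properties as Linked
open import Data.List.Relation.Unary.Unique.Propositional using (Unique; []; _∷_)
import Data.List.Relation.Unary.Unique.Propositional.Properties as Unique
open import Data.List.Relation.Binary.Permutation.Propositional
  using (_↭_; ↭-refl; ↭-sym; ↭-trans; ↭-prep; ↭-swap; ↭⇒↭ₛ)
open import Data.List.Relation.Binary.Permutation.Propositional.Properties using (↭-length; All-resp-↭)
import Data.List.Relation.Binary.Permutation.Setoid.Properties as PermutationSetoid
open import Data.Product using (Σ; ∃; ∃₂; _×_; _,_; proj₁; proj₂)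
open import Data.Sum using (_⊎_; inj₁; inj₂; [_,_]′) renaming (swap to ⊎-swap)
open import Function using (_∘_; _∘′_)
open import Relation.Nullary using (¬_; Dec; yes; no; ¬?; contradiction)
open import Relation.Nullary.Decidable using (_×-dec_; map′)
open import Relation.Unary using (Pred; Decidable; _⊆_)
open import Relation.Unary.Properties using (∁?)
open import Relation.Binary using (Rel; Symmetric; DecidableEquality)
import Relation.Binary.Definitions as Binary
open import Relation.Binary.PropositionalEquality hiding ([_])
open import Relation.Binary.Construct.Closure.ReflexiveTransitive using (Star; ε; _◅_)

module _ {P : Pred ℕ 0ℓ} (P? : Decidable P) where

  anyUpTo≤? : ∀ v → Dec (∃ λ n → n ≤ v × P n)
  anyUpTo≤? v = map′ (λ (n , n<1+v , pn) → n , s≤s⁻¹ n<1+v , pn)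
                     (λ (n , n≤v , pn) → n , s≤s n≤v , pn)
                     (anyUpTo? P? (suc v))

  Least : ℕ → Set
  Least v = ∃ λ n → n ≤ v × P n × (∀ {m} → m < n → ¬ P m)

  least : ∀ {v} → P v → Least v
  least {v} = <-rec (λ v → P v → Least v) step v
    where
    step : ∀ v → (∀ {u} → u < v → P u → Least u) → P v → Least v
    step v rec pv with anyUpTo? P? v
    ... | no none = v , ≤-refl , pv , λ m<v pm → none (_ , m<v , pm)
    ... | yes (u , u<v , pu) =
      let (n , n≤u , pn , min) = rec u<v pu in n , ≤-trans n≤u (<⇒≤ u<v) , pn , min

module _ {A : Set} where

  private
    remove : ∀ {x} (ys : List A) → x ∈ ys → List A
    remove (_ ∷ ys) (here _)   = ys
    remove (y ∷ ys) (there x∈) = y ∷ remove ys x∈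

    length-remove : ∀ {x} (ys : List A) (x∈ : x ∈ ys) → suc (length (remove ys x∈)) ≡ length ys
    length-remove (_ ∷ ys) (here _)   = refl
    length-remove (y ∷ ys) (there x∈) = cong suc (length-remove ys x∈)

    ∈-remove : ∀ {x v} (ys : List A) (x∈ : x ∈ ys) → v ∈ ys → v ≢ x → v ∈ remove ys x∈
    ∈-remove (_ ∷ ys) (here refl) (here refl) v≢x = contradiction refl v≢x
    ∈-remove (_ ∷ ys) (here refl) (there v∈) _   = v∈
    ∈-remove (_ ∷ ys) (there x∈)  (here v≡)  _   = here v≡
    ∈-remove (_ ∷ ys) (there x∈)  (there v∈) v≢x = there (∈-remove ys x∈ v∈ v≢x)

  unique-⊆⇒length≤ : ∀ {xs ys : List A} → Unique xs → (∀ {v} → v ∈ xs → v ∈ ys) → length xs ≤ length ys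
  unique-⊆⇒length≤ {[]}     _            _  = z≤n
  unique-⊆⇒length≤ {x ∷ xs} {ys} (x∉ ∷ u) xs⊆ys = begin
    suc (length xs)                  ≤⟨ s≤s (unique-⊆⇒length≤ u xs⊆rest) ⟩
    suc (length (remove ys x∈ys))    ≡⟨ length-remove ys x∈ys ⟩
    length ys                        ∎
    where
    open ≤-Reasoning
    x∈ys : x ∈ ys
    x∈ys = xs⊆ys (here refl)
    xs⊆rest : ∀ {v} → v ∈ xs → v ∈ remove ys x∈ys
    xs⊆rest v∈ = ∈-remove ys x∈ys (xs⊆ys (there v∈)) (λ v≡x → All.lookup x∉ v∈ (sym v≡x))

  length-filter+∁ : ∀ {P : Pred A 0ℓ} (P? : Decidable P) xs →
                    length xs ≡ length (filter P? xs) + length (filter (∁? P?) xs)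
  length-filter+∁ P? []       = refl
  length-filter+∁ P? (x ∷ xs) with P? x
  ... | yes _ = cong suc (length-filter+∁ P? xs)
  ... | no  _ = trans (cong suc (length-filter+∁ P? xs)) (sym (+-suc _ _))

  length-concatMap≤ : ∀ {B : Set} (f : A → List B) {D} → (∀ x → length (f x) ≤ D) →
                      ∀ xs → length (concatMap f xs) ≤ D * length xs
  length-concatMap≤ f {D} f≤D []       = z≤n
  length-concatMap≤ f {D} f≤D (x ∷ xs) = begin
    length (concatMap f (x ∷ xs))             ≡⟨ length-++ (f x) ⟩
    length (f x) + length (concatMap f xs)    ≤⟨ +-mono-≤ (f≤D x) (length-concatMap≤ f f≤D xs) ⟩
    D + D * length xs                         ≡⟨ sym (*-suc D (length xs)) ⟩
    D * suc (length xs)                       ∎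
    where open ≤-Reasoning

  Unique-resp-↭ : ∀ {xs ys : List A} → xs ↭ ys → Unique xs → Unique ys
  Unique-resp-↭ p = PermutationSetoid.Unique-resp-↭ (setoid A) (↭⇒↭ₛ p)

module SpacedPairs {X : Set} (key : X → ℕ) (gap capacity : ℕ)
  (window-capacity : ∀ s {Y : List X} → Unique Y → All (λ y → s ≤ key y × key y < s + gap) Y → length Y ≤ capacity)
  where

  record Spaced (j t : ℕ) : Set where
    field
      lo hi : Fin j → X
      lo≤hi : ∀ q → key (lo q) ≤ key (hi q)
      lo≢hi : ∀ q → lo q ≢ hi q
      above : ∀ q → t ≤ key (lo q)
      apart : ∀ {q r} → q ≢ r → key (hi q) + gap ≤ key (lo r) ⊎ key (hi r) + gap ≤ key (lo q)

  none : ∀ {t} → Spaced 0 t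
  none = record { lo = λ () ; hi = λ () ; lo≤hi = λ () ; lo≢hi = λ () ; above = λ () ; apart = λ { {()} } }

  prepend : ∀ {j t} x y → key x ≤ key y → x ≢ y → t ≤ key x → Spaced j (key y + gap) → Spaced (suc j) t
  prepend {j} {t} x y x≤y x≢y t≤x S = record
    { lo = lo′ ; hi = hi′ ; lo≤hi = lo≤hi′ ; lo≢hi = lo≢hi′ ; above = above′ ; apart = apart′ }
    where
    open Spaced S
    lo′ hi′ : Fin (suc j) → X
    lo′ zero = x
    lo′ (suc q) = lo q
    hi′ zero = y
    hi′ (suc q) = hi q
    lo≤hi′ : ∀ q → key (lo′ q) ≤ key (hi′ q)
    lo≤hi′ zero = x≤y
    lo≤hi′ (suc q) = lo≤hi q
    lo≢hi′ : ∀ q → lo′ q ≢ hi′ q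
    lo≢hi′ zero = x≢y
    lo≢hi′ (suc q) = lo≢hi q
    above′ : ∀ q → t ≤ key (lo′ q)
    above′ zero = t≤x
    above′ (suc q) = ≤-trans t≤x (≤-trans x≤y (≤-trans (m≤m+n (key y) gap) (above q)))
    apart′ : ∀ {q r} → q ≢ r → key (hi′ q) + gap ≤ key (lo′ r) ⊎ key (hi′ r) + gap ≤ key (lo′ q)
    apart′ {zero}  {zero}  q≢r = contradiction refl q≢r
    apart′ {zero}  {suc r} _   = inj₁ (above r)
    apart′ {suc q} {zero}  _   = inj₂ (above q)
    apart′ {suc q} {suc r} q≢r = apart (q≢r ∘ cong suc)

  record TwoSmallest (xs : List X) : Set where
    field
      first second : X
      rest         : List X
      perm         : first ∷ second ∷ rest ↭ xs
      first≤second : key first ≤ key second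
      second≤rest  : All (λ y → key second ≤ key y) rest

  private
    record Smallest (xs : List X) : Set where
      field
        min     : X
        rest    : List X
        perm    : min ∷ rest ↭ xs
        minimal : All (λ y → key min ≤ key y) rest

    smallest : ∀ x xs → Smallest (x ∷ xs)
    smallest x []       = record { min = x ; rest = [] ; perm = ↭-refl ; minimal = [] }
    smallest x (y ∷ ys) with smallest y ys
    ... | record { min = m ; rest = r ; perm = π ; minimal = m≤r } with key x ≤? key m
    ... | yes x≤m = record { min = x ; rest = m ∷ r ; perm = ↭-prep x π
                           ; minimal = x≤m ∷ All.map (≤-trans x≤m) m≤r }
    ... | no  x≰m = record { min = m ; rest = x ∷ r ; perm = ↭-trans (↭-swap m x ↭-refl) (↭-prep x π)
                           ; minimal = <⇒≤ (≰⇒> x≰m) ∷ m≤r }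

  twoSmallest : ∀ x y ys → TwoSmallest (x ∷ y ∷ ys)
  twoSmallest x y ys with smallest x (y ∷ ys)
  ... | record { rest = [] ; perm = π } = contradiction (↭-length π) λ ()
  ... | record { min = m ; rest = r ∷ rs ; perm = π ; minimal = m≤r } with smallest r rs
  ...   | record { min = m₂ ; rest = r₂ ; perm = π₂ ; minimal = m₂≤r₂ } = record
    { first = m ; second = m₂ ; rest = r₂ ; perm = ↭-trans (↭-prep m π₂) π
    ; first≤second = All.head (All-resp-↭ (↭-sym π₂) m≤r) ; second≤rest = m₂≤r₂ }

  select : ∀ j t (Z : List X) → Unique Z → All (λ z → t ≤ key z) Z → j * (2 + capacity) ≤ length Z → Spaced j t
  select zero    t Z            _  _  _   = none
  select (suc j) t []           _  _  ()
  select (suc j) t (_ ∷ [])     _  _  (s≤s ())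
  select (suc j) t (x ∷ y ∷ ys) uZ tZ len =
    prepend first second first≤second first≢second t≤first
      (select j (key second + gap) far (Unique.filter⁺ far? u-rest) (all-filter far? rest) j*K≤far)
    where
    open TwoSmallest (twoSmallest x y ys)
    far? : Decidable (λ z → key second + gap ≤ key z)
    far? z = key second + gap ≤? key z
    far near : List X
    far  = filter far? rest
    near = filter (∁? far?) rest
    u-all : Unique (first ∷ second ∷ rest)
    u-all = Unique-resp-↭ (↭-sym perm) uZ
    u-rest : Unique rest
    u-rest with _ ∷ _ ∷ u ← u-all = u
    first≢second : first ≢ second
    first≢second with (f≢s ∷ _) ∷ _ ← u-all = f≢s
    t≤first : t ≤ key first
    t≤first = All.head (All-resp-↭ (↭-sym perm) tZ)
    near≤capacity : length near ≤ capacity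
    near≤capacity = window-capacity (key second) (Unique.filter⁺ (∁? far?) u-rest)
      (All.zipWith (λ (s≤z , z≱) → s≤z , ≰⇒> z≱) (filter⁺ (∁? far?) second≤rest , all-filter (∁? far?) rest))
    j*K≤far : j * (2 + capacity) ≤ length far
    j*K≤far = +-cancelˡ-≤ (2 + capacity) _ _ (begin
      suc j * (2 + capacity)                       ≤⟨ len ⟩
      length (x ∷ y ∷ ys)                          ≡⟨ sym (↭-length perm) ⟩
      2 + length rest                              ≡⟨ cong (2 +_) (length-filter+∁ far? rest) ⟩
      2 + (length far + length near)               ≤⟨ +-monoʳ-≤ 2 (+-monoʳ-≤ (length far) near≤capacity) ⟩
      2 + (length far + capacity)                  ≡⟨ cong (2 +_) (+-comm (length far) capacity) ⟩
      2 + capacity + length far                    ∎)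
      where open ≤-Reasoning

module _ {X : Set} {R : Rel X 0ℓ} (R? : Binary.Decidable R) (R-sym : Symmetric R) where

  private
    length-filter-filter : ∀ {P Q : Pred X 0ℓ} (P? : Decidable P) (Q? : Decidable Q) xs →
                           length (filter P? (filter Q? xs)) ≤ length (filter P? xs)
    length-filter-filter P? Q? []       = z≤n
    length-filter-filter P? Q? (x ∷ xs) with Q? x
    ... | yes _ with P? x
    ...   | yes _ = s≤s (length-filter-filter P? Q? xs)
    ...   | no  _ = length-filter-filter P? Q? xs
    length-filter-filter P? Q? (x ∷ xs) | no _ with P? x
    ...   | yes _ = m≤n⇒m≤1+n (length-filter-filter P? Q? xs)
    ...   | no  _ = length-filter-filter P? Q? xs

  large-class⊎transversal : ∀ m M (L : List X) → m * suc M ≤ length L →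
    (∃ λ z → M < length (filter (R? z) L)) ⊎
    (∃ λ (zs : Fin m → X) → (∀ i → zs i ∈ L) × (∀ i j → R (zs i) (zs j) → i ≡ j))
  large-class⊎transversal zero    M L       _ = inj₂ ((λ ()) , (λ ()) , λ ())
  large-class⊎transversal (suc m) M []      ()
  large-class⊎transversal (suc m) M (z ∷ L) len with M <? length (filter (R? z) (z ∷ L))
  ... | yes large = inj₁ (z , large)
  ... | no  small with large-class⊎transversal m M others m*M≤others
    where
    others : List X
    others = filter (∁? (R? z)) (z ∷ L)
    m*M≤others : m * suc M ≤ length others
    m*M≤others = +-cancelˡ-≤ (suc M) _ _ (begin
      suc M + m * suc M                                          ≤⟨ len ⟩
      length (z ∷ L)                                             ≡⟨ length-filter+∁ (R? z) (z ∷ L) ⟩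
      length (filter (R? z) (z ∷ L)) + length others             ≤⟨ +-monoˡ-≤ _ (≮⇒≥ small) ⟩
      M + length others                                          ≤⟨ n≤1+n _ ⟩
      suc M + length others                                      ∎)
      where open ≤-Reasoning
  ... | inj₁ (z′ , large) = inj₁ (z′ , <-≤-trans large (length-filter-filter (R? z′) (∁? (R? z)) (z ∷ L)))
  ... | inj₂ (zs , zs∈ , sep) = inj₂ (zs′ , zs′∈ , sep′)
    where
    zs′ : Fin (suc m) → X
    zs′ zero    = z
    zs′ (suc i) = zs i
    zs′∈ : ∀ i → zs′ i ∈ z ∷ L
    zs′∈ zero    = here refl
    zs′∈ (suc i) = proj₁ (∈-filter⁻ (∁? (R? z)) (zs∈ i))
    unrelated : ∀ i → ¬ R z (zs i)
    unrelated i = proj₂ (∈-filter⁻ (∁? (R? z)) (zs∈ i))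
    sep′ : ∀ i j → R (zs′ i) (zs′ j) → i ≡ j
    sep′ zero    zero    _ = refl
    sep′ zero    (suc j) r = contradiction r (unrelated j)
    sep′ (suc i) zero    r = contradiction (R-sym r) (unrelated i)
    sep′ (suc i) (suc j) r = cong suc (sep i j r)

module Walks {V : Set} (_~_ : Rel V 0ℓ) (~-sym : Symmetric _~_) (_≟_ : DecidableEquality V) where

  -- A walk of length k visits at 0, …, at k; the values of at beyond k are irrelevant.
  record Walk (S : Pred V 0ℓ) (x y : V) (k : ℕ) : Set where
    field
      at     : ℕ → V
      at-0   : at 0 ≡ x
      at-k   : at k ≡ y
      step   : ∀ i → i < k → at i ~ at (suc i)
      inside : ∀ i → i ≤ k → S (at i)

  open Walk public

  private variable
    S S′ : Pred V 0ℓ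
    x x′ y y′ z : V
    i j k m r r′ : ℕ

  Reach : Pred V 0ℓ → Rel V 0ℓ
  Reach S x y = ∃ (Walk S x y)

  Within : Pred V 0ℓ → ℕ → Rel V 0ℓ
  Within S r x y = ∃ λ k → k ≤ r × Walk S x y k

  cast : x ≡ x′ → y ≡ y′ → Walk S x y k → Walk S x′ y′ k
  cast x≡x′ y≡y′ W = record
    { at = at W ; at-0 = trans (at-0 W) x≡x′ ; at-k = trans (at-k W) y≡y′ ; step = step W ; inside = inside W }

  relabel : (W : Walk S x y k) → (∀ i → i ≤ k → S′ (at W i)) → Walk S′ x y k
  relabel W t = record { at = at W ; at-0 = at-0 W ; at-k = at-k W ; step = step W ; inside = t }

  mono : S ⊆ S′ → Walk S x y k → Walk S′ x y k
  mono S⊆S′ W = relabel W (λ i i≤k → S⊆S′ (inside W i i≤k))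

  stay : S x → Walk S x x 0
  stay {x = x} sx = record { at = λ _ → x ; at-0 = refl ; at-k = refl ; step = λ _ () ; inside = λ _ _ → sx }

  cons : S x → x ~ y → Walk S y z k → Walk S x z (suc k)
  cons {S = S} {x = x} {k = k} sx x~y W = record { at = at′ ; at-0 = refl ; at-k = at-k W ; step = step′ ; inside = inside′ }
    where
    at′ : ℕ → V
    at′ zero    = x
    at′ (suc i) = at W i
    step′ : ∀ i → i < suc k → at′ i ~ at′ (suc i)
    step′ zero    _   = subst (x ~_) (sym (at-0 W)) x~y
    step′ (suc i) i<k = step W i (s≤s⁻¹ i<k)
    inside′ : ∀ i → i ≤ suc k → S (at′ i)
    inside′ zero    _   = sx
    inside′ (suc i) i≤k = inside W i (s≤s⁻¹ i≤k)

  tail : (W : Walk S x z (suc k)) → Walk S (at W 1) z k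
  tail W = record { at = at W ∘′ suc ; at-0 = refl ; at-k = at-k W ; step = λ i i<k → step W (suc i) (s≤s i<k)
                  ; inside = λ i i≤k → inside W (suc i) (s≤s i≤k) }

  first-step : (W : Walk S x z (suc k)) → x ~ at W 1
  first-step W = subst (_~ at W 1) (at-0 W) (step W 0 z<s)

  start-inside : Walk S x y k → S x
  start-inside W = subst _ (at-0 W) (inside W 0 z≤n)

  end-inside : Walk S x y k → S y
  end-inside {k = k} W = subst _ (at-k W) (inside W k ≤-refl)

  infixr 5 _◅◅_
  _◅◅_ : Walk S x y k → Walk S y z m → Walk S x z (k + m)
  _◅◅_ {k = zero}  W U = cast (trans (sym (at-k W)) (at-0 W)) refl U
  _◅◅_ {k = suc k} W U = cons (start-inside W) (first-step W) (tail W ◅◅ U)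

  reverse : Walk S x y k → Walk S y x k
  reverse {k = k} W = record
    { at     = λ i → at W (k ∸ i)
    ; at-0   = at-k W
    ; at-k   = trans (cong (at W) (n∸n≡0 k)) (at-0 W)
    ; step   = λ i i<k → ~-sym (subst (λ j → at W (k ∸ suc i) ~ at W j) (sym (+-∸-assoc 1 i<k))
                                       (step W (k ∸ suc i) (∸-monoʳ-< {k} z<s i<k)))
    ; inside = λ i _ → inside W (k ∸ i) (m∸n≤m k i)
    }

  segment : (W : Walk S x y k) → i ≤ j → j ≤ k →
            Walk (λ v → ∃ λ s → i ≤ s × s ≤ j × v ≡ at W s) (at W i) (at W j) (j ∸ i)
  segment {i = i} {j = j} W i≤j j≤k = record
    { at     = λ t → at W (i + t)
    ; at-0   = cong (at W) (+-identityʳ i)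
    ; at-k   = cong (at W) (m+[n∸m]≡n i≤j)
    ; step   = λ t t<j∸i → subst (λ s → at W (i + t) ~ at W s) (sym (+-suc i t))
                                  (step W (i + t) (≤-trans (subst (_≤ j) (+-suc i t) (i+t≤j t<j∸i)) j≤k))
    ; inside = λ t t≤j∸i → i + t , m≤m+n i t , i+t≤j t≤j∸i , refl
    }
    where
    i+t≤j : ∀ {t} → t ≤ j ∸ i → i + t ≤ j
    i+t≤j {t} t≤ = subst (i + t ≤_) (m+[n∸m]≡n i≤j) (+-monoʳ-≤ i t≤)

  take : (W : Walk S x y k) → i ≤ k → Walk S x (at W i) i
  take W i≤k =
    cast (at-0 W) refl (mono (λ { (s , _ , s≤i , refl) → inside W s (≤-trans s≤i i≤k) }) (segment W z≤n i≤k))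

  drop : (W : Walk S x y k) → i ≤ k → Walk S (at W i) y (k ∸ i)
  drop W i≤k = cast refl (at-k W) (mono (λ { (s , _ , s≤k , refl) → inside W s s≤k }) (segment W i≤k ≤-refl))

  reach-at : (W : Walk S x y k) → i ≤ k → Reach S x (at W i)
  reach-at W i≤k = _ , take W i≤k

  along : Walk S x y k → Walk (Reach S x) x y k
  along W = relabel W (λ i i≤k → reach-at W i≤k)

  reach-sym : Reach S x y → Reach S y x
  reach-sym (_ , W) = _ , reverse W

  reach-trans : Reach S x y → Reach S y z → Reach S x z
  reach-trans (_ , W) (_ , U) = _ , W ◅◅ U

  reach-end : Reach S x y → S y
  reach-end (_ , W) = end-inside W

  within-sym : Within S r x y → Within S r y x
  within-sym (k , k≤r , W) = k , k≤r , reverse W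

  within-trans : Within S r x y → Within S r′ y z → Within S (r + r′) x z
  within-trans (k , k≤r , W) (m , m≤r′ , U) = k + m , +-mono-≤ k≤r m≤r′ , W ◅◅ U

  within-weaken : r ≤ r′ → Within S r x y → Within S r′ x y
  within-weaken r≤r′ (k , k≤r , W) = k , ≤-trans k≤r r≤r′ , W

  Simple : Walk S x y k → Set
  Simple {k = k} W = ∀ {i j} → i < j → j ≤ k → at W i ≢ at W j

  private
    shortcut : (W : Walk S x y k) → i < j → j ≤ k → at W i ≡ at W j → Walk S x y (i + (k ∸ j))
    shortcut W i<j j≤k eq = take W (≤-trans (<⇒≤ i<j) j≤k) ◅◅ cast (sym eq) refl (drop W j≤k)

    shortcut-shorter : i < j → j ≤ k → i + (k ∸ j) < k
    shortcut-shorter {i} {j} {k} i<j j≤k = begin-strict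
      i + (k ∸ j)   <⟨ +-monoˡ-< (k ∸ j) i<j ⟩
      j + (k ∸ j)   ≡⟨ m+[n∸m]≡n j≤k ⟩
      k             ∎
      where open ≤-Reasoning

  simplify : Walk S x y k → ∃ λ k′ → Σ (Walk S x y k′) Simple
  simplify {S = S} {x = x} {y = y} {k = k} = <-rec (λ k → Walk S x y k → ∃ λ k′ → Σ (Walk S x y k′) Simple) go k
    where
    go : ∀ k → (∀ {k′} → k′ < k → Walk S x y k′ → ∃ λ k″ → Σ (Walk S x y k″) Simple) →
         Walk S x y k → ∃ λ k′ → Σ (Walk S x y k′) Simple
    go k rec W with anyUpTo≤? (λ j → anyUpTo? (λ i → at W i ≟ at W j) j) k
    ... | no noRepeat = k , W , λ i<j j≤k eq → noRepeat (_ , j≤k , _ , i<j , eq)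
    ... | yes (j , j≤k , i , i<j , eq) = rec (shortcut-shorter i<j j≤k) (shortcut W i<j j≤k eq)

  trail : Walk S x y k → List V
  trail {k = k} W = applyUpTo (at W) (suc k)

  trail-linked : (W : Walk S x y k) → Linked _~_ (trail W)
  trail-linked {k = k} W = Linked.applyUpTo⁺₁ (at W) (suc k) (λ i<k → step W _ (s≤s⁻¹ i<k))

  trail-unique : (W : Walk S x y k) → Simple W → Unique (trail W)
  trail-unique {k = k} W simple = Unique.applyUpTo⁺₁ (at W) (suc k) (λ i<j j≤k → simple i<j (s≤s⁻¹ j≤k))

  ∈-trail : (W : Walk S x y k) → ∀ {v} → v ∈ trail W → S v
  ∈-trail W v∈ with i , i≤k , refl ← ∈-applyUpTo⁻ (at W) v∈ = inside W i (s≤s⁻¹ i≤k)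

  start⊎within-end : (W : Walk S x y k) → k ≤ suc r → ∀ i → i ≤ k → at W i ≡ x ⊎ Within S r (at W i) y
  start⊎within-end W _ zero _ = inj₁ (at-0 W)
  start⊎within-end {k = k} W k≤1+r (suc i) i<k =
    inj₂ (k ∸ suc i , ≤-trans (∸-monoʳ-≤ k (s≤s z≤n)) (m≤n+o⇒m∸n≤o k 1 k≤1+r) , drop W i<k)

module GraphWalks {n : ℕ} (G : Graph n) where

  Adj-sym : Symmetric (Adj G)
  Adj-sym {u} {v} = subst T (Graph.sym G u v)

  open Walks (Adj G) Adj-sym _≟ᶠ_ public

  private variable
    S : Pred (Fin n) 0ℓ
    x y z : Fin n
    k r : ℕ

  Touch : Rel (Fin n) 0ℓ
  Touch x y = x ≡ y ⊎ Adj G x y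

  walk? : Decidable S → ∀ k x y → Dec (Walk S x y k)
  walk? S? zero x y with S? x | x ≟ᶠ y
  ... | yes sx | yes refl = yes (stay sx)
  ... | no ¬sx | _        = no (¬sx ∘ start-inside)
  ... | _      | no x≢y   = no λ W → x≢y (trans (sym (at-0 W)) (at-k W))
  walk? S? (suc k) x y with S? x | any? (λ v → T? (adj G x v) ×-dec walk? S? k v y)
  ... | yes sx | yes (v , x~v , W) = yes (cons sx x~v W)
  ... | no ¬sx | _                 = no (¬sx ∘ start-inside)
  ... | _      | no noStep         = no λ W → noStep (at W 1 , first-step W , tail W)

  simple⇒length<n : (W : Walk S x y k) → Simple W → k < n
  simple⇒length<n {k = k} W simple = begin
    suc k                ≡⟨ sym (length-applyUpTo (at W) (suc k)) ⟩
    length (trail W)     ≤⟨ unique-⊆⇒length≤ (trail-unique W simple) (λ {v} _ → ∈-allFin v) ⟩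
    length (allFin n)    ≡⟨ length-tabulate (λ i → i) ⟩
    n                    ∎
    where open ≤-Reasoning

  reach? : Decidable S → Binary.Decidable (Reach S)
  reach? S? x y = map′ (λ (k , _ , W) → k , W) short (anyUpTo? (λ k → walk? S? k x y) n)
    where
    short : Reach S x y → ∃ λ k → k < n × Walk S x y k
    short (_ , W) with k , W′ , simple ← simplify W = k , simple⇒length<n W′ simple , W′

  within? : Decidable S → ∀ r → Binary.Decidable (Within S r)
  within? S? r x y = anyUpTo≤? (λ k → walk? S? k x y) r

  toPath : Walk S x y k → x ≢ y → Σ (Path G) λ P → start P ≡ x × end P ≡ y × (∀ {v} → v ∈ vertices P → S v)
  toPath W x≢y with simplify W
  ... | zero  , W′ , _      = contradiction (trans (sym (at-0 W′)) (at-k W′)) x≢y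
  ... | suc m , W′ , simple = P , at-0 W′ , at-k W′ , λ {v} v∈ → ∈-trail W′ (subst (v ∈_) (sym trail≡) v∈)
    where
    trail≡ : trail W′ ≡ at W′ 0 ∷ applyUpTo (at W′ ∘ suc) m ++ [ at W′ (suc m) ]
    trail≡ = cong (at W′ 0 ∷_) (sym (applyUpTo-∷ʳ (at W′ ∘ suc) m))
    P : Path G
    P = record
      { start    = at W′ 0
      ; interior = applyUpTo (at W′ ∘ suc) m
      ; end      = at W′ (suc m)
      ; linked   = subst (Linked (Adj G)) trail≡ (trail-linked W′)
      ; distinct = subst Unique trail≡ (trail-unique W′ simple)
      }

  separated⇒anticomplete : ∀ {A B : Pred (Fin n) 0ℓ} (P Q : Path G) →
                 (∀ {v} → v ∈ vertices P → A v) → (∀ {v} → v ∈ vertices Q → B v) →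
                 (∀ {x y} → A x → B y → ¬ Touch x y) → AntiComplete P Q
  separated⇒anticomplete P Q inP inQ apart =
    (λ x x∈P x∈Q → apart (inP x∈P) (inQ x∈Q) (inj₁ refl)) ,
    (λ x y x∈P y∈Q x~y → apart (inP x∈P) (inQ y∈Q) (inj₂ x~y))

  touch-sym : Touch x y → Touch y x
  touch-sym (inj₁ refl) = inj₁ refl
  touch-sym (inj₂ x~y)  = inj₂ (Adj-sym x~y)

  touch-within : S x → Touch x y → Within S r y z → Within S (suc r) x z
  touch-within _  (inj₁ refl) w               = within-weaken (n≤1+n _) w
  touch-within sx (inj₂ x~y)  (k , k≤r , W)   = suc k , s≤s k≤r , cons sx x~y W

  reach-touch : Reach S z x → S y → Touch x y → Reach S z y
  reach-touch r _  (inj₁ refl) = r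
  reach-touch r sy (inj₂ x~y)  = reach-trans r (1 , cons (reach-end r) x~y (stay sy))

  star⇒reach : Star (Adj G) x y → Reach (λ _ → ⊤) x y
  star⇒reach ε          = 0 , stay tt
  star⇒reach (x~y ◅ xs) with k , W ← star⇒reach xs = suc k , cons tt x~y W

  neighbours : Fin n → List (Fin n)
  neighbours v = filterᵇ (adj G v) (allFin n)

  ball : ℕ → Fin n → List (Fin n)
  ball zero    x = [ x ]
  ball (suc r) x = concatMap (λ v → v ∷ neighbours v) (ball r x)

  private
    ∈-ball-step : ∀ r {x u v} → u ∈ ball r x → Touch u v → v ∈ ball (suc r) x
    ∈-ball-step _ u∈ u~v = ∈-concatMap⁺ _ (Any.map (λ { refl → near u~v }) u∈)
      where
      near : ∀ {u v} → Touch u v → v ∈ u ∷ neighbours u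
      near (inj₁ refl) = here refl
      near (inj₂ u~v)  = there (∈-filter⁺ (T? ∘ adj G _) (∈-allFin _) u~v)

  ∈-ball : Within S r x y → y ∈ ball r x
  ∈-ball {r = zero}  (zero , _ , W)   = here (trans (sym (at-k W)) (at-0 W))
  ∈-ball {r = suc r} (zero , _ , W)   = ∈-ball-step r (∈-ball {r = r} (zero , z≤n , W)) (inj₁ refl)
  ∈-ball {r = suc r} (suc k , k<r , W) =
    ∈-ball-step r (∈-ball (k , s≤s⁻¹ k<r , take W (n≤1+n k))) (inj₂ (subst (Adj G _) (at-k W) (step W k ≤-refl)))

  length-ball : ∀ {Δ} → MaxDegreeAtMost G Δ → ∀ r x → length (ball r x) ≤ suc Δ ^ r
  length-ball maxDeg zero    x = ≤-refl
  length-ball {Δ} maxDeg (suc r) x =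
    ≤-trans (length-concatMap≤ _ (λ v → s≤s (maxDeg v)) (ball r x)) (*-monoʳ-≤ (suc Δ) (length-ball maxDeg r x))

-- 1 + (Δ + 1) ^ 2 bounds the 𝒜-vertices near P, and (Δ + 1) ^ 6 the hooks attached in a window of 5.
bound : ℕ → ℕ → ℕ
bound zero    Δ = 0
bound (suc d) Δ = suc (suc Δ ^ 2) + suc d * (2 + suc Δ ^ 6) * suc (bound d Δ)

module Packings {n : ℕ} (G : Graph n) {Δ : ℕ} (maxDeg : MaxDegreeAtMost G Δ) (𝒜 : Subset n) where

  open GraphWalks G

  private variable
    S : Pred (Fin n) 0ℓ
    d k : ℕ

  record Region : Set₁ where
    field
      U         : Pred (Fin n) 0ℓ
      U?        : Decidable U
      connected : ∀ {x y} → U x → U y → Reach U x y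

  component : Decidable S → Fin n → Region
  component {S} S? z = record
    { U         = Reach S z
    ; U?        = reach? S? z
    ; connected = λ (_ , Wx) (_ , Wy) → _ , reverse (along Wx) ◅◅ along Wy
    }

  record Packing (d : ℕ) (U : Pred (Fin n) 0ℓ) : Set where
    field
      paths        : Fin d → Path G
      isAPath      : ∀ i → IsAPath 𝒜 (paths i)
      antiComplete : ∀ i j → i ≢ j → AntiComplete (paths i) (paths j)
      inRegion     : ∀ i {v} → v ∈ vertices (paths i) → U v

  packing-cons : ∀ {U A B : Pred (Fin n) 0ℓ} (P : Path G) → IsAPath 𝒜 P → (∀ {v} → v ∈ vertices P → A v) →
                 Packing d B → (∀ {x y} → A x → B y → ¬ Touch x y) → A ⊆ U → B ⊆ U → Packing (suc d) U
  packing-cons {d} {U} P P-𝒜 P⊆A Q A∥B A⊆U B⊆U = record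
    { paths = paths′ ; isAPath = isAPath′ ; antiComplete = antiComplete′ ; inRegion = inRegion′ }
    where
    open Packing Q
    paths′ : Fin (suc d) → Path G
    paths′ zero    = P
    paths′ (suc i) = paths i
    isAPath′ : ∀ i → IsAPath 𝒜 (paths′ i)
    isAPath′ zero    = P-𝒜
    isAPath′ (suc i) = isAPath i
    antiComplete′ : ∀ i j → i ≢ j → AntiComplete (paths′ i) (paths′ j)
    antiComplete′ zero    zero    i≢j = contradiction refl i≢j
    antiComplete′ zero    (suc j) _   = separated⇒anticomplete P (paths j) P⊆A (inRegion j) A∥B
    antiComplete′ (suc i) zero    _   = separated⇒anticomplete (paths i) P (inRegion i) P⊆A
                                          (λ By Ax → A∥B Ax By ∘ touch-sym)
    antiComplete′ (suc i) (suc j) i≢j = antiComplete i j (i≢j ∘ cong suc)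
    inRegion′ : ∀ i {v} → v ∈ vertices (paths′ i) → U v
    inRegion′ zero    = A⊆U ∘ P⊆A
    inRegion′ (suc i) = B⊆U ∘ inRegion i

  Packs : ℕ → Set₁
  Packs d = ∀ (R : Region) {L} → Unique L → All (λ v → v ∈ₛ 𝒜 × Region.U R v) L → bound d Δ ≤ length L →
            Packing d (Region.U R)

  AWalk : Pred (Fin n) 0ℓ → ℕ → Set
  AWalk U k = ∃₂ λ a b → a ∈ₛ 𝒜 × b ∈ₛ 𝒜 × a ≢ b × Walk U a b k

  record Geodesic (U : Pred (Fin n) 0ℓ) : Set where
    field
      a b      : Fin n
      a∈𝒜      : a ∈ₛ 𝒜
      b∈𝒜      : b ∈ₛ 𝒜
      a≢b      : a ≢ b
      ℓ        : ℕ
      P        : Walk U a b ℓ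
      shortest : ∀ {x y k} → x ∈ₛ 𝒜 → y ∈ₛ 𝒜 → x ≢ y → Walk U x y k → ℓ ≤ k

  geodesic : ∀ {U} → Decidable U → AWalk U k → Geodesic U
  geodesic {U = U} U? w with least AWalk? w
    where
    AWalk? : Decidable (AWalk U)
    AWalk? k = any? λ a → any? λ b → a ∈? 𝒜 ×-dec b ∈? 𝒜 ×-dec ¬? (a ≟ᶠ b) ×-dec walk? U? k a b
  ... | ℓ , _ , (a , b , a∈𝒜 , b∈𝒜 , a≢b , P) , minimal = record
    { a = a ; b = b ; a∈𝒜 = a∈𝒜 ; b∈𝒜 = b∈𝒜 ; a≢b = a≢b ; ℓ = ℓ ; P = P
    ; shortest = λ x∈𝒜 y∈𝒜 x≢y W → ≮⇒≥ λ k<ℓ → minimal k<ℓ (_ , _ , x∈𝒜 , y∈𝒜 , x≢y , W) }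

  module AroundGeodesic (R : Region) (γ : Geodesic (Region.U R)) where
    open Region R
    open Geodesic γ

    p : ℕ → Fin n
    p = at P

    U-p : ∀ {s} → s ≤ ℓ → U (p s)
    U-p = inside P _

    geodesic-bound : ∀ {s s′ r} → s ≤ ℓ → s′ ≤ ℓ → Within U r (p s) (p s′) → s′ ≤ s + r
    geodesic-bound {s} {s′} {r} s≤ℓ s′≤ℓ (q , q≤r , Q) = +-cancelʳ-≤ (ℓ ∸ s′) s′ (s + r) (begin
      s′ + (ℓ ∸ s′)        ≡⟨ m+[n∸m]≡n s′≤ℓ ⟩
      ℓ                    ≤⟨ shortest a∈𝒜 b∈𝒜 a≢b (take P s≤ℓ ◅◅ Q ◅◅ drop P s′≤ℓ) ⟩
      s + (q + (ℓ ∸ s′))   ≡⟨ sym (+-assoc s q _) ⟩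
      s + q + (ℓ ∸ s′)     ≤⟨ +-monoˡ-≤ _ (+-monoʳ-≤ s q≤r) ⟩
      s + r + (ℓ ∸ s′)     ∎)
      where open ≤-Reasoning

    Near : ℕ → Pred (Fin n) 0ℓ
    Near r v = ∃ λ s → s ≤ ℓ × Within U r v (p s)

    near? : ∀ r → Decidable (Near r)
    near? r v = anyUpTo≤? (λ s → within? U? r v (p s)) ℓ

    near⇒U : ∀ {r v} → Near r v → U v
    near⇒U (_ , _ , _ , _ , W) = start-inside W

    Outside : Pred (Fin n) 0ℓ
    Outside v = U v × ¬ Near 1 v

    outside? : Decidable Outside
    outside? v = U? v ×-dec ¬? (near? 1 v)

    near-𝒜 : ∀ {c} → c ∈ₛ 𝒜 → Near 1 c → c ∈ b ∷ ball 2 a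
    near-𝒜 {c} c∈𝒜 (s , s≤ℓ , q , q≤1 , Q) with c ≟ᶠ b
    ... | yes refl = here refl
    ... | no  c≢b  = there (∈-ball (s + q , +-mono-≤ (≤-trans s≤q q≤1) q≤1 , take P s≤ℓ ◅◅ reverse Q))
      where
      s≤q : s ≤ q
      s≤q = +-cancelʳ-≤ (ℓ ∸ s) s q (begin
        s + (ℓ ∸ s)   ≡⟨ m+[n∸m]≡n s≤ℓ ⟩
        ℓ             ≤⟨ shortest c∈𝒜 b∈𝒜 c≢b (Q ◅◅ drop P s≤ℓ) ⟩
        q + (ℓ ∸ s)   ∎)
        where open ≤-Reasoning

    length-near-𝒜 : ∀ {L} → Unique L → All (λ v → v ∈ₛ 𝒜 × U v) L →
                    length (filter (near? 1) L) ≤ suc (suc Δ ^ 2)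
    length-near-𝒜 {L} uL 𝒜L =
      ≤-trans (unique-⊆⇒length≤ (Unique.filter⁺ (near? 1) uL) near⊆) (s≤s (length-ball maxDeg 2 a))
      where
      near⊆ : ∀ {v} → v ∈ filter (near? 1) L → v ∈ b ∷ ball 2 a
      near⊆ v∈ with v∈L , near ← ∈-filter⁻ (near? 1) v∈ = near-𝒜 (proj₁ (All.lookup 𝒜L v∈L)) near

    P-path : Σ (Path G) λ Q → start Q ≡ a × end Q ≡ b × (∀ {v} → v ∈ vertices Q → Near 0 v)
    P-path = toPath (relabel P (λ s s≤ℓ → s , s≤ℓ , 0 , z≤n , stay (U-p s≤ℓ))) a≢b

    near₀∥outside : ∀ {x y} → Near 0 x → Outside y → ¬ Touch x y
    near₀∥outside (s , s≤ℓ , w) (Uy , ¬near) x~y = ¬near (s , s≤ℓ , touch-within Uy (touch-sym x~y) w)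

    record Hook (z : Fin n) : Set where
      field
        c        : Fin n
        pos      : ℕ
        pos≤ℓ    : pos ≤ ℓ
        link     : Within U 2 c (p pos)
        len      : ℕ
        approach : Walk (λ v → Reach Outside z v × (¬ Near 2 v ⊎ v ≡ c)) z c len

    -- Abstract, so that conversion checking never unfolds the searches performed by hook.
    abstract
      hook : ∀ {z} → Outside z → Hook z
      hook {z} (Uz , ¬near) with connected Uz (start-inside P)
      ... | len , Q with least (near? 2 ∘ at Q) {len} a-near
        where
        a-near : Near 2 (at Q len)
        a-near = 0 , z≤n , subst (λ v → Within U 2 v (p 0)) (trans (at-0 P) (sym (at-k Q))) (0 , z≤n , stay (U-p z≤n))
      ... | t , t≤len , (s , s≤ℓ , link) , before =
        record { c = at Q t ; pos = s ; pos≤ℓ = s≤ℓ ; link = link ; len = t ; approach = approach }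
        where
        not-near₁ : ∀ i → i ≤ t → ¬ Near 1 (at Q i)
        not-near₁ zero    _   = subst (λ v → ¬ Near 1 v) (sym (at-0 Q)) ¬near
        not-near₁ (suc i) i<t (s , s≤ℓ , w) =
          before i<t (s , s≤ℓ , touch-within (inside Q i (<⇒≤ i<len)) (inj₂ (step Q i i<len)) w)
          where
          i<len : i < len
          i<len = <-≤-trans i<t t≤len
        toward : Walk Outside z (at Q t) t
        toward = relabel (take Q t≤len) (λ i i≤t → inside Q i (≤-trans i≤t t≤len) , not-near₁ i i≤t)
        far-or-end : ∀ i → i ≤ t → ¬ Near 2 (at Q i) ⊎ at Q i ≡ at Q t
        far-or-end i i≤t with m≤n⇒m<n∨m≡n i≤t
        ... | inj₁ i<t  = inj₁ (before i<t)
        ... | inj₂ refl = inj₂ refl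
        approach : Walk (λ v → Reach Outside z v × (¬ Near 2 v ⊎ v ≡ at Q t)) z (at Q t) t
        approach = relabel (along toward) (λ i i≤t → inside (along toward) i i≤t , far-or-end i i≤t)

    module Separated {m : ℕ} (zs : Fin m → Fin n) (zs-𝒜 : ∀ i → zs i ∈ₛ 𝒜) (zs-outside : ∀ i → Outside (zs i))
                     (separated : ∀ i j → Reach Outside (zs i) (zs j) → i ≡ j) where

      private
        module H (i : Fin m) = Hook (hook (zs-outside i))
      open H using (c; pos; pos≤ℓ; link; approach)

      reach-c : ∀ i → Reach Outside (zs i) (c i)
      reach-c i = proj₁ (end-inside (approach i))

      c-injective : ∀ {i j} → c i ≡ c j → i ≡ j
      c-injective {i} {j} ci≡cj =
        separated i j (reach-trans (reach-c i) (reach-sym (subst (Reach Outside (zs j)) (sym ci≡cj) (reach-c j))))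

      zs-injective : ∀ {i j} → zs i ≡ zs j → i ≡ j
      zs-injective {i} {j} zi≡zj = separated i j (subst (Reach Outside (zs i)) zi≡zj (0 , stay (zs-outside i)))

      along-P : ∀ {s s′} → s ≤ s′ → s′ ≤ ℓ → Within U (s′ ∸ s) (p s) (p s′)
      along-P s≤s′ s′≤ℓ =
        _ , ≤-refl , mono (λ { (t , _ , t≤s′ , refl) → U-p (≤-trans t≤s′ s′≤ℓ) }) (segment P s≤s′ s′≤ℓ)

      window-capacity : ∀ s {Y} → Unique Y → All (λ i → s ≤ pos i × pos i < s + 5) Y → length Y ≤ suc Δ ^ 6
      window-capacity s {Y} uY inWindow = begin
        length Y                ≡⟨ sym (length-map c Y) ⟩
        length (map c Y)        ≤⟨ unique-⊆⇒length≤ (Unique.map⁺ c-injective uY) c∈ball ⟩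
        length (ball 6 (p s))   ≤⟨ length-ball maxDeg 6 (p s) ⟩
        suc Δ ^ 6               ∎
        where
        open ≤-Reasoning
        offset≤4 : ∀ {t} → t < s + 5 → t ∸ s ≤ 4
        offset≤4 {t} t<s+5 = m≤n+o⇒m∸n≤o t s (s≤s⁻¹ (subst (suc t ≤_) (+-suc s 4) t<s+5))
        c∈ball : ∀ {v} → v ∈ map c Y → v ∈ ball 6 (p s)
        c∈ball v∈ with i , i∈Y , refl ← ∈-map⁻ c v∈ =
          let (s≤pos , pos<s+5) = All.lookup inWindow i∈Y in
          ∈-ball (within-weaken (+-monoˡ-≤ 2 (offset≤4 pos<s+5))
                   (within-trans (along-P s≤pos (pos≤ℓ i)) (within-sym (link i))))

      Close : ℕ → ℕ → ℕ → Pred (Fin n) 0ℓ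
      Close r α β v = ∃ λ s → α ≤ s × s ≤ β × Within U r v (p s)

      Tag : ℕ → ℕ → Pred (Fin n) 0ℓ
      Tag α β v = (∃ λ i → α ≤ pos i × pos i ≤ β × Reach Outside (zs i) v × (¬ Near 2 v ⊎ Close 2 α β v))
                ⊎ Close 1 α β v

      tag⇒U : ∀ {α β v} → Tag α β v → U v
      tag⇒U (inj₁ (_ , _ , _ , r , _))        = proj₁ (reach-end r)
      tag⇒U (inj₂ (_ , _ , _ , _ , _ , W))    = start-inside W

      Apart : ℕ → ℕ → ℕ → ℕ → Set
      Apart α β α′ β′ = β + 5 ≤ α′ ⊎ β′ + 5 ≤ α

      module Conflict {α β α′ β′} (β≤ℓ : β ≤ ℓ) (β′≤ℓ : β′ ≤ ℓ) (apart : Apart α β α′ β′) where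

        far : ∀ {s s′} → α ≤ s → s ≤ β → α′ ≤ s′ → s′ ≤ β′ → ¬ Within U 4 (p s) (p s′)
        far {s} {s′} α≤s s≤β α′≤s′ s′≤β′ w =
          [ (λ gap → too-close (≤-trans (+-monoˡ-≤ 5 s≤β) (≤-trans gap α′≤s′))
                               (geodesic-bound s≤ℓ s′≤ℓ w))
          , (λ gap → too-close (≤-trans (+-monoˡ-≤ 5 s′≤β′) (≤-trans gap α≤s))
                               (geodesic-bound s′≤ℓ s≤ℓ (within-sym w)))
          ]′ apart
          where
          s≤ℓ : s ≤ ℓ
          s≤ℓ = ≤-trans s≤β β≤ℓ
          s′≤ℓ : s′ ≤ ℓ
          s′≤ℓ = ≤-trans s′≤β′ β′≤ℓ
          too-close : ∀ {t t′} → t + 5 ≤ t′ → t′ ≤ t + 4 → ⊥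
          too-close {t} t+5≤t′ t′≤t+4 = ≤⇒≯ (≤-trans t+5≤t′ t′≤t+4) (+-monoʳ-< t (n<1+n 4))

        conflict-AA : ∀ {i j x y} → α ≤ pos i → pos i ≤ β → α′ ≤ pos j → pos j ≤ β′ →
                      Reach Outside (zs i) x → Reach Outside (zs j) y → ¬ Touch x y
        conflict-AA {i} {j} α≤i i≤β α′≤j j≤β′ rx ry x~y
          with refl ← separated i j (reach-trans (reach-touch rx (reach-end ry) x~y) (reach-sym ry)) =
          far α≤i i≤β α′≤j j≤β′ (0 , z≤n , stay (U-p (pos≤ℓ i)))

        conflict-AB : ∀ {i x y} → Reach Outside (zs i) x → ¬ Near 2 x ⊎ Close 2 α β x → Close 1 α′ β′ y →
                      ¬ Touch x y
        conflict-AB rx (inj₁ ¬near) (s′ , _ , s′≤β′ , wy) x~y =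
          ¬near (s′ , ≤-trans s′≤β′ β′≤ℓ , touch-within (proj₁ (reach-end rx)) x~y wy)
        conflict-AB rx (inj₂ (s , α≤s , s≤β , wx)) (s′ , α′≤s′ , s′≤β′ , wy) x~y =
          far α≤s s≤β α′≤s′ s′≤β′ (within-trans (within-sym wx) (touch-within (proj₁ (reach-end rx)) x~y wy))

        conflict-BB : ∀ {x y} → Close 1 α β x → Close 1 α′ β′ y → ¬ Touch x y
        conflict-BB (s , α≤s , s≤β , wx) (s′ , α′≤s′ , s′≤β′ , wy) x~y =
          far α≤s s≤β α′≤s′ s′≤β′ (within-weaken (n≤1+n 3)
            (within-trans (within-sym wx) (touch-within (start-inside (proj₂ (proj₂ wx))) x~y wy)))

      conflict : ∀ {α β α′ β′ x y} → β ≤ ℓ → β′ ≤ ℓ → Apart α β α′ β′ →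
                 Tag α β x → Tag α′ β′ y → ¬ Touch x y
      conflict β≤ℓ β′≤ℓ apart (inj₁ (_ , α≤i , i≤β , rx , _)) (inj₁ (_ , α′≤j , j≤β′ , ry , _)) =
        Conflict.conflict-AA β≤ℓ β′≤ℓ apart α≤i i≤β α′≤j j≤β′ rx ry
      conflict β≤ℓ β′≤ℓ apart (inj₁ (_ , _ , _ , rx , info)) (inj₂ close) =
        Conflict.conflict-AB β≤ℓ β′≤ℓ apart rx info close
      conflict β≤ℓ β′≤ℓ apart (inj₂ close) (inj₁ (_ , _ , _ , ry , info)) =
        Conflict.conflict-AB β′≤ℓ β≤ℓ (⊎-swap apart) ry info close ∘ touch-sym
      conflict β≤ℓ β′≤ℓ apart (inj₂ close) (inj₂ close′) =
        Conflict.conflict-BB β≤ℓ β′≤ℓ apart close close′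

      hook-walk : ∀ {α β} i → α ≤ pos i → pos i ≤ β → ∃ (Walk (Tag α β) (zs i) (p (pos i)))
      hook-walk {α} {β} i α≤i i≤β with q , q≤2 , L ← link i =
        _ , mono approach-tag (approach i) ◅◅ relabel L link-tag
        where
        approach-tag : ∀ {v} → Reach Outside (zs i) v × (¬ Near 2 v ⊎ v ≡ c i) → Tag α β v
        approach-tag (r , inj₁ ¬near) = inj₁ (i , α≤i , i≤β , r , inj₁ ¬near)
        approach-tag (r , inj₂ refl)  = inj₁ (i , α≤i , i≤β , r , inj₂ (pos i , α≤i , i≤β , link i))
        link-tag : ∀ t → t ≤ q → Tag α β (at L t)
        link-tag t t≤q with start⊎within-end L q≤2 t t≤q
        ... | inj₁ at≡c = subst (Tag α β) (sym at≡c) (approach-tag (reach-c i , inj₂ refl))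
        ... | inj₂ w    = inj₂ (pos i , α≤i , i≤β , w)

      pair-walk : ∀ {i j} → pos i ≤ pos j → ∃ (Walk (Tag (pos i) (pos j)) (zs i) (zs j))
      pair-walk {i} {j} i≤j = _ , proj₂ (hook-walk i ≤-refl i≤j) ◅◅ mono segment-tag (segment P i≤j (pos≤ℓ j))
                                    ◅◅ reverse (proj₂ (hook-walk j i≤j ≤-refl))
        where
        segment-tag : ∀ {v} → (∃ λ s → pos i ≤ s × s ≤ pos j × v ≡ p s) → Tag (pos i) (pos j) v
        segment-tag (s , i≤s , s≤j , refl) = inj₂ (s , i≤s , s≤j , 0 , z≤n , stay (U-p (≤-trans s≤j (pos≤ℓ j))))

      pair-path : ∀ {i j} → pos i ≤ pos j → i ≢ j →
                  Σ (Path G) λ Q → IsAPath 𝒜 Q × (∀ {v} → v ∈ vertices Q → Tag (pos i) (pos j) v)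
      pair-path {i} {j} i≤j i≢j
        with Q , start≡ , end≡ , tagged ← toPath (proj₂ (pair-walk i≤j)) (i≢j ∘ zs-injective) =
        Q , (subst (_∈ₛ 𝒜) (sym start≡) (zs-𝒜 i) , subst (_∈ₛ 𝒜) (sym end≡) (zs-𝒜 j)) , tagged

      module Pairs = SpacedPairs pos 5 (suc Δ ^ 6) window-capacity

      packing : ∀ {d} → m ≡ suc d * (2 + suc Δ ^ 6) → Packing (suc d) U
      packing {d} m≡ = record
        { paths        = λ q → proj₁ (pair q)
        ; isAPath      = λ q → proj₁ (proj₂ (pair q))
        ; antiComplete = λ q r q≢r →
            separated⇒anticomplete (proj₁ (pair q)) (proj₁ (pair r)) (proj₂ (proj₂ (pair q))) (proj₂ (proj₂ (pair r)))
              (conflict (pos≤ℓ (hi q)) (pos≤ℓ (hi r)) (apart q≢r))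
        ; inRegion     = λ q → tag⇒U ∘ proj₂ (proj₂ (pair q))
        }
        where
        open Pairs.Spaced (Pairs.select (suc d) 0 (allFin m) (Unique.allFin⁺ m) (All.tabulate λ _ → z≤n)
                                         (≤-reflexive (trans (sym m≡) (sym (length-tabulate (λ i → i))))))
        pair : ∀ q → Σ (Path G) λ Q → IsAPath 𝒜 Q × (∀ {v} → v ∈ vertices Q → Tag (pos (lo q)) (pos (hi q)) v)
        pair q = pair-path (lo≤hi q) (lo≢hi q)

    far-from-P : List (Fin n) → List (Fin n)
    far-from-P = filter (∁? (near? 1))

    far-from-P-outside : ∀ {L} → All (λ v → v ∈ₛ 𝒜 × U v) L → All (λ v → v ∈ₛ 𝒜 × Outside v) (far-from-P L)
    far-from-P-outside {L} 𝒜L = All.zipWith (λ ((v∈𝒜 , Uv) , ¬near) → v∈𝒜 , Uv , ¬near)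
                                            (filter⁺ (∁? (near? 1)) 𝒜L , all-filter (∁? (near? 1)) L)

    length-far-from-P : ∀ {d L} → Unique L → All (λ v → v ∈ₛ 𝒜 × U v) L → bound (suc d) Δ ≤ length L →
                        suc d * (2 + suc Δ ^ 6) * suc (bound d Δ) ≤ length (far-from-P L)
    length-far-from-P {d} {L} uL 𝒜L len = +-cancelˡ-≤ (suc (suc Δ ^ 2)) _ _ (begin
      bound (suc d) Δ                                       ≤⟨ len ⟩
      length L                                              ≡⟨ length-filter+∁ (near? 1) L ⟩
      length (filter (near? 1) L) + length (far-from-P L)   ≤⟨ +-monoˡ-≤ _ (length-near-𝒜 uL 𝒜L) ⟩
      suc (suc Δ ^ 2) + length (far-from-P L)               ∎)
      where open ≤-Reasoning

    add-P-to-component : ∀ {d} → Packs d → ∀ z {L} → Unique L → All (λ v → v ∈ₛ 𝒜 × Reach Outside z v) L →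
                         bound d Δ ≤ length L → Packing (suc d) U
    add-P-to-component IH z uL 𝒜L len with Q , start≡ , end≡ , Q-near ← P-path =
      packing-cons Q (subst (_∈ₛ 𝒜) (sym start≡) a∈𝒜 , subst (_∈ₛ 𝒜) (sym end≡) b∈𝒜) Q-near
        (IH (component outside? z) uL 𝒜L len) (λ near r → near₀∥outside near (reach-end r))
        near⇒U (proj₁ ∘ reach-end)

    packs-step : ∀ {d} → Packs d → ∀ {L} → Unique L → All (λ v → v ∈ₛ 𝒜 × U v) L → bound (suc d) Δ ≤ length L →
                 Packing (suc d) U
    packs-step {d} IH {L} uL 𝒜L len
      with large-class⊎transversal (reach? outside?) reach-sym (suc d * (2 + suc Δ ^ 6)) (bound d Δ) (far-from-P L)
                                 (length-far-from-P {d} uL 𝒜L len)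
    ... | inj₁ (z , large) =
      add-P-to-component IH z (Unique.filter⁺ (reach? outside? z) (Unique.filter⁺ (∁? (near? 1)) uL))
        (All.zipWith (λ ((v∈𝒜 , _) , r) → v∈𝒜 , r)
          (filter⁺ (reach? outside? z) (far-from-P-outside 𝒜L) , all-filter (reach? outside? z) (far-from-P L)))
        (<⇒≤ large)
    ... | inj₂ (zs , zs∈ , separated) =
      Separated.packing zs (proj₁ ∘ zs-far) (proj₂ ∘ zs-far) separated refl
      where
      zs-far : ∀ i → zs i ∈ₛ 𝒜 × Outside (zs i)
      zs-far i = All.lookup (far-from-P-outside 𝒜L) (zs∈ i)

  whole : Connected G → Region
  whole connected = record
    { U = λ _ → ⊤ ; U? = λ _ → yes tt ; connected = λ {x} {y} _ _ → star⇒reach (connected x y) }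

  𝒜-walk : ∀ (R : Region) {L} → Unique L → All (λ v → v ∈ₛ 𝒜 × Region.U R v) L → 2 ≤ length L →
           ∃ (AWalk (Region.U R))
  𝒜-walk R {[]}    _ _ ()
  𝒜-walk R {_ ∷ []} _ _ (s≤s ())
  𝒜-walk R {x ∷ y ∷ _} (x∉ ∷ _) ((x∈𝒜 , Ux) ∷ (y∈𝒜 , Uy) ∷ _) _ =
    let (k , W) = Region.connected R Ux Uy in k , x , y , x∈𝒜 , y∈𝒜 , All.head x∉ , W

  packs : ∀ d → Packs d
  packs zero    R _ _ _ = record { paths = λ () ; isAPath = λ () ; antiComplete = λ () ; inRegion = λ () }
  packs (suc d) R uL 𝒜L len = AroundGeodesic.packs-step R γ (packs d) uL 𝒜L len
    where
    two≤bound : 2 ≤ bound (suc d) Δ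
    two≤bound = s≤s (≤-trans (m^n>0 (suc Δ) 2) (m≤m+n _ _))
    γ : Geodesic (Region.U R)
    γ = geodesic (Region.U? R) (proj₂ (𝒜-walk R uL 𝒜L (≤-trans two≤bound len)))

elements : ∀ {n} → Subset n → List (Fin n)
elements []          = []
elements (true  ∷ p) = zero ∷ map suc (elements p)
elements (false ∷ p) = map suc (elements p)

length-elements : ∀ {n} (p : Subset n) → length (elements p) ≡ ∣ p ∣
length-elements []          = refl
length-elements (true  ∷ p) = cong suc (trans (length-map suc (elements p)) (length-elements p))
length-elements (false ∷ p) = trans (length-map suc (elements p)) (length-elements p)

elements-unique : ∀ {n} (p : Subset n) → Unique (elements p)
elements-unique []          = []
elements-unique (true  ∷ p) = All.tabulate zero∉ ∷ Unique.map⁺ Fin.suc-injective (elements-unique p)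
  where
  zero∉ : ∀ {v} → v ∈ map suc (elements p) → zero ≢ v
  zero∉ v∈ with _ , _ , refl ← ∈-map⁻ suc v∈ = Fin.0≢1+n
elements-unique (false ∷ p) = Unique.map⁺ Fin.suc-injective (elements-unique p)

∈-elements : ∀ {n} (p : Subset n) {v} → v ∈ elements p → v ∈ₛ p
∈-elements (true  ∷ p) (here refl) = here
∈-elements (true  ∷ p) (there v∈) with _ , v∈′ , refl ← ∈-map⁻ suc v∈ = there (∈-elements p v∈′)
∈-elements (false ∷ p) v∈         with _ , v∈′ , refl ← ∈-map⁻ suc v∈ = there (∈-elements p v∈′)

theorem15 : Σ (ℕ → ℕ → ℕ) λ f →
    ∀ (d Δ : ℕ) {n : ℕ} (G : Graph n) → Connected G → MaxDegreeAtMost G Δ →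
    (𝒜 : Subset n) → f d Δ ≤ ∣ 𝒜 ∣ →
    Σ (Fin d → Path G) λ P →
      (∀ i → IsAPath 𝒜 (P i)) × (∀ i j → ¬ i ≡ j → AntiComplete (P i) (P j))
theorem15 = bound , λ d Δ G connected maxDeg 𝒜 |𝒜|≥ →
  let open Packings G maxDeg 𝒜
      open Packing (packs d (whole connected) (elements-unique 𝒜) (All.tabulate λ v∈ → ∈-elements 𝒜 v∈ , tt)
                      (subst (bound d Δ ≤_) (sym (length-elements 𝒜)) |𝒜|≥))
  in paths , isAPath , antiComplete
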